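{- For $n\ge 0$, \[b_1(n+1)-b_1(n)=\begin{cases}0 & n \text{ even},\\ (n+1)\,B\big(\tfrac{n+1}{2}\big) & n\text{ odd}.\end{cases}\]
   Context: $\mathcal B(n)$ is the set of binary partitions of $n$ (all parts powers of $2$), $B(n)=|\mathcal B(n)|$, $m_\lambda(i)$ the number of parts of $\lambda$ equal to $i$. For $n\ge1$ and $\lambda\in\mathcal B(n)$ let $h_{\mathcal B,\lambda}(x)=\prod_{i=0}^{\lfloor\log_2 n\rfloor}(1+x^{2^i})^{\lfloor n/2^i\rfloor-m_\lambda(2^i)}$ and $\mathrm{num}_{\mathcal B}(n,x)=\sum_{\lambda\in\mathcal B(n)}h_{\mathcal B,\lambda}(x)$; set $\mathrm{num}_{\mathcal B}(0,x)=1$. $b_1(n)$ denotes the coefficient of $x$ in $\mathrm{num}_{\mathcal B}(n,x)$. -}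

module Defs where

open import Data.Nat using (ℕ; zero; suc; _+_; _*_; _∸_; _^_; _≤?_)
open import Data.Nat.DivMod using (_/_)
open import Data.Nat.Properties using (m^n≢0)
open import Data.Nat.Logarithm using (⌊log₂_⌋)
open import Data.List using (List; []; _∷_; [_]; map; concatMap; filter; upTo; length; foldr; zipWith)

-- Polynomials with ℕ coefficients: coefficient lists, lowest degree first.
Poly : Set
Poly = List ℕ

_⊕_ : Poly → Poly → Poly
[] ⊕ q = q
(a ∷ p) ⊕ [] = a ∷ p
(a ∷ p) ⊕ (b ∷ q) = (a + b) ∷ (p ⊕ q)

scale : ℕ → Poly → Poly
scale c = map (c *_)

_⊗_ : Poly → Poly → Poly
[] ⊗ q = []
(a ∷ p) ⊗ q = scale a q ⊕ (0 ∷ (p ⊗ q))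

one : Poly
one = [ 1 ]

_^ᴾ_ : Poly → ℕ → Poly
p ^ᴾ zero = one
p ^ᴾ suc k = p ⊗ (p ^ᴾ k)

xpow : ℕ → Poly
xpow zero = [ 1 ]
xpow (suc d) = 0 ∷ xpow d

coeff : ℕ → Poly → ℕ
coeff k [] = 0
coeff zero (a ∷ p) = a
coeff (suc k) (a ∷ p) = coeff k p

range : ℕ → List ℕ
range k = upTo (suc k)

binParts : ℕ → List ℕ
binParts n = map (2 ^_) (range ⌊log₂ n ⌋)

mults : List ℕ → ℕ → List (List ℕ)
mults [] zero = [ [] ]
mults [] (suc _) = []
mults (p ∷ ps) n =
  concatMap (λ m → map (m ∷_) (mults ps (n ∸ m * p)))
            (filter (λ m → m * p ≤? n) (range n))

-- 𝓑(n): binary partitions of n, each encoded by its multiplicity list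
-- (m_λ(2^0), m_λ(2^1), ..., m_λ(2^⌊log₂ n⌋)).
BinPart : ℕ → List (List ℕ)
BinPart n = mults (binParts n) n

B : ℕ → ℕ
B n = length (BinPart n)

hB : ℕ → List ℕ → Poly
hB n ms = foldr _⊗_ one
  (zipWith (λ i m → (one ⊕ xpow (2 ^ i)) ^ᴾ ((n / 2 ^ i) {{m^n≢0 2 i}} ∸ m))
           (range ⌊log₂ n ⌋) ms)

sumP : List Poly → Poly
sumP = foldr _⊕_ []

numB : ℕ → Poly
numB zero = one
numB n@(suc _) = sumP (map (hB n) (BinPart n))

b₁ : ℕ → ℕ
b₁ n = coeff 1 (numB n)

{-# OPTIONS --safe #-}

-- In h_{𝓑,λ} every factor except (1 + x)^(n - m_λ(1)) is 1 modulo x², so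
-- b₁(n) = Σ_λ (n - m_λ(1)). Grouping the partitions by m = m_λ(1), what remains
-- is a binary partition of r = n - m into even parts; writing evenB r for their
-- number, b₁(n) = Σ_{r ≤ n} r · evenB r, so b₁(n+1) - b₁(n) = (n+1) · evenB (n+1).
-- Finally evenB vanishes at odd arguments, and halving every part gives
-- evenB (2j) = B(j).

module Submission where

open import Defs
open import Data.Nat using (ℕ; zero; suc; _+_; _*_; _∸_; _^_; _%_; _/_; _≤_; _<_; _≤?_; _≤′_; ≤′-refl; NonZero; ≤′-step; z≤n; s≤s)
open import Data.Nat.Properties
open import Data.Nat.DivMod using (n/1≡n; m*[n/m]≡n; %-distribˡ-+)
open import Data.Nat.Divisibility using (m%n≡0⇒n∣m)
open import Data.Nat.Logarithm using (⌊log₂_⌋; ⌊log₂⌋-mono-≤; ⌊log₂[2*b]⌋≡1+⌊log₂b⌋; ⌊log₂[2^n]⌋≡n)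
open import Data.Nat.ListAction using (sum)
open import Data.Nat.ListAction.Properties using (sum-++)
open import Data.List using (List; []; _∷_; [_]; _++_; map; concatMap; filter; upTo; applyUpTo; length; foldr; zipWith)
open import Data.List.Properties using (length-++; length-map; map-++; map-cong; map-∘; map-upTo; applyUpTo-∷ʳ; upTo-∷ʳ; filter-accept; filter-reject; filter-none; filter-all; filter-≐; filter-++; ++-identityʳ)
open import Data.Integer using (+_; _-_)
open import Data.Integer.Properties using ([+m]-[+n]≡m⊖n; ⊖-≥)
open import Data.Product using (_×_; _,_)
open import Data.List.Relation.Unary.All as All using (All; []; _∷_)
open import Data.List.Relation.Unary.All.Properties using (map⁺; applyUpTo⁺₂; all-upTo; all-filter)
open import Relation.Nullary using (¬_; yes; no; contradiction)
open import Relation.Unary using (Decidable)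
open import Function using (_∘_; id)
open import Relation.Binary.PropositionalEquality using (_≡_; refl; sym; trans; cong; cong₂; subst; module ≡-Reasoning)
open import Algebra.Properties.CommutativeSemigroup *-commutativeSemigroup using (x∙yz≈y∙xz)

open ≡-Reasoning

all-zipWith : ∀ {A B C : Set} {P : A → Set} {Q : C → Set} (f : A → B → C) →
  (∀ x y → P x → Q (f x y)) → ∀ {xs} → All P xs → ∀ ys → All Q (zipWith f xs ys)
all-zipWith f fPQ []         ys       = []
all-zipWith f fPQ (px ∷ pxs) []       = []
all-zipWith f fPQ (px ∷ pxs) (y ∷ ys) = fPQ _ y px ∷ all-zipWith f fPQ pxs ys

length-concatMap : ∀ {A B : Set} (f : A → List B) xs → length (concatMap f xs) ≡ sum (map (length ∘ f) xs)
length-concatMap f []       = refl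
length-concatMap f (x ∷ xs) = trans (length-++ (f x)) (cong (_+_ (length (f x))) (length-concatMap f xs))

sum-concatMap : ∀ {A B : Set} (φ : B → ℕ) (f : A → List B) xs →
  sum (map φ (concatMap f xs)) ≡ sum (map (sum ∘ map φ ∘ f) xs)
sum-concatMap φ f []       = refl
sum-concatMap φ f (x ∷ xs) = begin
  sum (map φ (f x ++ concatMap f xs))              ≡⟨ cong sum (map-++ φ (f x) _) ⟩
  sum (map φ (f x) ++ map φ (concatMap f xs))      ≡⟨ sum-++ (map φ (f x)) _ ⟩
  sum (map φ (f x)) + sum (map φ (concatMap f xs)) ≡⟨ cong (_+_ (sum (map φ (f x)))) (sum-concatMap φ f xs) ⟩
  sum (map φ (f x)) + sum (map (sum ∘ map φ ∘ f) xs) ∎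

sum-map-const : ∀ {A : Set} {f : A → ℕ} {c xs} → All (λ x → f x ≡ c) xs → sum (map f xs) ≡ c * length xs
sum-map-const {c = c} []           = sym (*-zeroʳ c)
sum-map-const {c = c} (fx≡c ∷ fxs≡c) = trans (cong₂ _+_ fx≡c (sum-map-const fxs≡c)) (sym (*-suc c _))

filter-upTo-beyond : ∀ {P : ℕ → Set} (P? : Decidable P) {K K′} → K ≤′ K′ → (∀ k → K ≤ k → ¬ P k) →
  filter P? (upTo K′) ≡ filter P? (upTo K)
filter-upTo-beyond P? ≤′-refl                ¬P = refl
filter-upTo-beyond P? {K} (≤′-step {K′} K≤′K′) ¬P = begin
  filter P? (upTo (suc K′))                 ≡⟨ cong (filter P?) (sym (upTo-∷ʳ K′)) ⟩
  filter P? (upTo K′ ++ [ K′ ])             ≡⟨ filter-++ P? (upTo K′) [ K′ ] ⟩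
  filter P? (upTo K′) ++ filter P? [ K′ ]   ≡⟨ cong₂ _++_ (filter-upTo-beyond P? K≤′K′ ¬P) (filter-reject P? (¬P K′ (≤′⇒≤ K≤′K′))) ⟩
  filter P? (upTo K) ++ []                  ≡⟨ ++-identityʳ _ ⟩
  filter P? (upTo K)                        ∎

sum-range-∷ʳ : ∀ (g : ℕ → ℕ) n → sum (map g (range (suc n))) ≡ sum (map g (range n)) + g (suc n)
sum-range-∷ʳ g n = begin
  sum (map g (range (suc n)))                 ≡⟨ cong (sum ∘ map g) (upTo-∷ʳ (suc n)) ⟨
  sum (map g (range n ++ [ suc n ]))          ≡⟨ cong sum (map-++ g (range n) [ suc n ]) ⟩
  sum (map g (range n) ++ [ g (suc n) ])      ≡⟨ sum-++ (map g (range n)) [ g (suc n) ] ⟩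
  sum (map g (range n)) + (g (suc n) + 0)     ≡⟨ cong (_+_ (sum (map g (range n)))) (+-identityʳ (g (suc n))) ⟩
  sum (map g (range n)) + g (suc n)           ∎

sum-range-reflect : ∀ (g : ℕ → ℕ) n → sum (map (λ m → g (n ∸ m)) (range n)) ≡ sum (map g (range n))
sum-range-reflect g zero    = refl
sum-range-reflect g (suc n) = begin
  g (suc n) + sum (map (λ m → g (suc n ∸ m)) (applyUpTo suc (suc n)))
    ≡⟨ cong (λ ms → g (suc n) + sum (map (λ m → g (suc n ∸ m)) ms)) (map-upTo suc (suc n)) ⟨
  g (suc n) + sum (map (λ m → g (suc n ∸ m)) (map suc (range n)))
    ≡⟨ cong (λ k → g (suc n) + sum k) (map-∘ (range n)) ⟨
  g (suc n) + sum (map (λ m → g (n ∸ m)) (range n))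
    ≡⟨ cong (_+_ (g (suc n))) (sum-range-reflect g n) ⟩
  g (suc n) + sum (map g (range n))
    ≡⟨ +-comm (g (suc n)) _ ⟩
  sum (map g (range n)) + g (suc n)
    ≡⟨ sum-range-∷ʳ g n ⟨
  sum (map g (range (suc n))) ∎

coeff-⊕ : ∀ k p q → coeff k (p ⊕ q) ≡ coeff k p + coeff k q
coeff-⊕ k       []      q       = refl
coeff-⊕ k       (a ∷ p) []      = sym (+-identityʳ _)
coeff-⊕ zero    (a ∷ p) (b ∷ q) = refl
coeff-⊕ (suc k) (a ∷ p) (b ∷ q) = coeff-⊕ k p q

coeff-scale : ∀ k a q → coeff k (scale a q) ≡ a * coeff k q
coeff-scale k       a []      = sym (*-zeroʳ a)
coeff-scale zero    a (b ∷ q) = refl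
coeff-scale (suc k) a (b ∷ q) = coeff-scale k a q

coeff₀-⊗ : ∀ p q → coeff 0 (p ⊗ q) ≡ coeff 0 p * coeff 0 q
coeff₀-⊗ []      q = refl
coeff₀-⊗ (a ∷ p) q = begin
  coeff 0 (scale a q ⊕ (0 ∷ (p ⊗ q))) ≡⟨ coeff-⊕ 0 (scale a q) _ ⟩
  coeff 0 (scale a q) + 0             ≡⟨ +-identityʳ _ ⟩
  coeff 0 (scale a q)                 ≡⟨ coeff-scale 0 a q ⟩
  a * coeff 0 q                       ∎

coeff₁-⊗ : ∀ p q → coeff 1 (p ⊗ q) ≡ coeff 0 p * coeff 1 q + coeff 1 p * coeff 0 q
coeff₁-⊗ []      q = refl
coeff₁-⊗ (a ∷ p) q = begin
  coeff 1 (scale a q ⊕ (0 ∷ (p ⊗ q))) ≡⟨ coeff-⊕ 1 (scale a q) _ ⟩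
  coeff 1 (scale a q) + coeff 0 (p ⊗ q) ≡⟨ cong₂ _+_ (coeff-scale 1 a q) (coeff₀-⊗ p q) ⟩
  a * coeff 1 q + coeff 0 p * coeff 0 q ∎

coeff₀-^ᴾ : ∀ {p} → coeff 0 p ≡ 1 → ∀ e → coeff 0 (p ^ᴾ e) ≡ 1
coeff₀-^ᴾ     p₀ zero    = refl
coeff₀-^ᴾ {p} p₀ (suc e) = trans (coeff₀-⊗ p (p ^ᴾ e)) (cong₂ _*_ p₀ (coeff₀-^ᴾ p₀ e))

coeff₁-^ᴾ : ∀ {p} → coeff 0 p ≡ 1 → ∀ e → coeff 1 (p ^ᴾ e) ≡ e * coeff 1 p
coeff₁-^ᴾ     p₀ zero    = refl
coeff₁-^ᴾ {p} p₀ (suc e) = begin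
  coeff 1 (p ⊗ (p ^ᴾ e))
    ≡⟨ coeff₁-⊗ p (p ^ᴾ e) ⟩
  coeff 0 p * coeff 1 (p ^ᴾ e) + coeff 1 p * coeff 0 (p ^ᴾ e)
    ≡⟨ cong₂ _+_ (cong₂ _*_ p₀ (coeff₁-^ᴾ p₀ e)) (cong (coeff 1 p *_) (coeff₀-^ᴾ p₀ e)) ⟩
  1 * (e * coeff 1 p) + coeff 1 p * 1
    ≡⟨ cong₂ _+_ (*-identityˡ (e * coeff 1 p)) (*-identityʳ (coeff 1 p)) ⟩
  e * coeff 1 p + coeff 1 p
    ≡⟨ +-comm (e * coeff 1 p) _ ⟩
  suc e * coeff 1 p ∎

coeff₁-sumP : ∀ ps → coeff 1 (sumP ps) ≡ sum (map (coeff 1) ps)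
coeff₁-sumP []       = refl
coeff₁-sumP (p ∷ ps) = trans (coeff-⊕ 1 p (sumP ps)) (cong (_+_ (coeff 1 p)) (coeff₁-sumP ps))

record OneModX² (p : Poly) : Set where
  constructor _,_
  field
    coeff₀≡1 : coeff 0 p ≡ 1
    coeff₁≡0 : coeff 1 p ≡ 0

coeff₁-⊗-oneModX² : ∀ p {q} → OneModX² q → coeff 1 (p ⊗ q) ≡ coeff 1 p
coeff₁-⊗-oneModX² p {q} (q₀ , q₁) = begin
  coeff 1 (p ⊗ q)                               ≡⟨ coeff₁-⊗ p q ⟩
  coeff 0 p * coeff 1 q + coeff 1 p * coeff 0 q ≡⟨ cong₂ _+_ (cong (coeff 0 p *_) q₁) (cong (coeff 1 p *_) q₀) ⟩
  coeff 0 p * 0 + coeff 1 p * 1                 ≡⟨ cong₂ _+_ (*-zeroʳ (coeff 0 p)) (*-identityʳ (coeff 1 p)) ⟩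
  coeff 1 p                                     ∎

oneModX²-⊗ : ∀ {p q} → OneModX² p → OneModX² q → OneModX² (p ⊗ q)
oneModX²-⊗ {p} {q} (p₀ , p₁) (q₀ , q₁) = trans (coeff₀-⊗ p q) (cong₂ _*_ p₀ q₀)
                                        , trans (coeff₁-⊗-oneModX² p (q₀ , q₁)) p₁

oneModX²-^ᴾ : ∀ {p} → OneModX² p → ∀ e → OneModX² (p ^ᴾ e)
oneModX²-^ᴾ (p₀ , p₁) e = coeff₀-^ᴾ p₀ e , trans (coeff₁-^ᴾ p₀ e) (trans (cong (e *_) p₁) (*-zeroʳ e))

oneModX²-product : ∀ {ps} → All OneModX² ps → OneModX² (foldr _⊗_ one ps)
oneModX²-product []       = refl , refl
oneModX²-product (p ∷ ps) = oneModX²-⊗ p (oneModX²-product ps)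

oneModX²-1+xᵈ : ∀ {d} → 2 ≤ d → OneModX² (one ⊕ xpow d)
oneModX²-1+xᵈ (s≤s (s≤s _)) = refl , refl

hB-coeff₁ : ∀ n m ms → coeff 1 (hB n (m ∷ ms)) ≡ n ∸ m
hB-coeff₁ n m ms = begin
  coeff 1 (factor 0 m ⊗ rest) ≡⟨ coeff₁-⊗-oneModX² (factor 0 m) rest-oneModX² ⟩
  coeff 1 (factor 0 m)        ≡⟨ coeff₁-^ᴾ refl (n / 1 ∸ m) ⟩
  (n / 1 ∸ m) * 1             ≡⟨ *-identityʳ _ ⟩
  n / 1 ∸ m                   ≡⟨ cong (_∸ m) (n/1≡n n) ⟩
  n ∸ m                       ∎
  where
  factor : ℕ → ℕ → Poly
  factor i m = (one ⊕ xpow (2 ^ i)) ^ᴾ ((n / 2 ^ i) {{m^n≢0 2 i}} ∸ m)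
  rest : Poly
  rest = foldr _⊗_ one (zipWith factor (applyUpTo suc ⌊log₂ n ⌋) ms)
  2≤2^suc : ∀ i → 2 ≤ 2 ^ suc i
  2≤2^suc i = *-monoʳ-≤ 2 (m^n>0 2 i)
  factor-oneModX² : ∀ i m → 2 ≤ 2 ^ i → OneModX² (factor i m)
  factor-oneModX² i m 2≤2ⁱ = oneModX²-^ᴾ (oneModX²-1+xᵈ 2≤2ⁱ) ((n / 2 ^ i) {{m^n≢0 2 i}} ∸ m)
  rest-oneModX² : OneModX² rest
  rest-oneModX² = oneModX²-product
    (all-zipWith factor factor-oneModX² (applyUpTo⁺₂ suc ⌊log₂ n ⌋ 2≤2^suc) ms)

count : List ℕ → ℕ → ℕ
count ps n = length (mults ps n)

multiplicities : ℕ → ℕ → List ℕ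
multiplicities p n = filter (λ m → m * p ≤? n) (range n)

count-∷ : ∀ p ps n → count (p ∷ ps) n ≡ sum (map (λ m → count ps (n ∸ m * p)) (multiplicities p n))
count-∷ p ps n = trans (length-concatMap (λ m → map (m ∷_) (mults ps (n ∸ m * p))) (multiplicities p n))
  (cong sum (map-cong (λ m → length-map (m ∷_) (mults ps (n ∸ m * p))) (multiplicities p n)))

multiplicities-one : ∀ n → multiplicities 1 n ≡ range n
multiplicities-one n = filter-all (λ m → m * 1 ≤? n) (All.map fits (all-upTo (suc n)))
  where
  fits : ∀ {m} → m < suc n → m * 1 ≤ n
  fits {m} m<1+n = subst (_≤ n) (sym (*-identityʳ m)) (m<1+n⇒m≤n m<1+n)

multiplicities-beyond : ∀ {q r} → r < q → multiplicities q r ≡ [ 0 ]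
multiplicities-beyond {q} {r} r<q =
  trans (filter-accept (λ m → m * q ≤? r) {xs = applyUpTo suc r} z≤n)
        (cong (0 ∷_) (filter-none (λ m → m * q ≤? r) (applyUpTo⁺₂ suc r too-big)))
  where
  too-big : ∀ m → ¬ (suc m * q ≤ r)
  too-big m le = <⇒≱ r<q (≤-trans (m≤m+n q (m * q)) le)

multiplicities-double : ∀ p .{{_ : NonZero p}} j → multiplicities (2 * p) (2 * j) ≡ multiplicities p j
multiplicities-double p j = begin
  filter (λ m → m * (2 * p) ≤? 2 * j) (range (2 * j))
    ≡⟨ filter-≐ (λ m → m * (2 * p) ≤? 2 * j) (λ m → m * p ≤? j) ((λ {m} → halve {m}) , (λ {m} → double {m})) (range (2 * j)) ⟩
  filter (λ m → m * p ≤? j) (range (2 * j))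
    ≡⟨ filter-upTo-beyond (λ m → m * p ≤? j) (≤⇒≤′ (s≤s (m≤m+n j (j + 0)))) too-big ⟩
  filter (λ m → m * p ≤? j) (range j) ∎
  where
  halve : ∀ {m} → m * (2 * p) ≤ 2 * j → m * p ≤ j
  halve {m} le = *-cancelˡ-≤ 2 (subst (_≤ 2 * j) (x∙yz≈y∙xz m 2 p) le)
  double : ∀ {m} → m * p ≤ j → m * (2 * p) ≤ 2 * j
  double {m} le = subst (_≤ 2 * j) (sym (x∙yz≈y∙xz m 2 p)) (*-monoʳ-≤ 2 le)
  too-big : ∀ k → suc j ≤ k → ¬ (k * p ≤ j)
  too-big k j<k kp≤j = <⇒≱ j<k (≤-trans (m≤m*n k p) kp≤j)

count-++-beyond : ∀ ps {q r} → r < q → count (ps ++ [ q ]) r ≡ count ps r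
count-++-beyond [] {q} {r} r<q = begin
  count [ q ] r                                                 ≡⟨ count-∷ q [] r ⟩
  sum (map (λ m → count [] (r ∸ m * q)) (multiplicities q r))   ≡⟨ cong (sum ∘ map (λ m → count [] (r ∸ m * q))) (multiplicities-beyond r<q) ⟩
  count [] r + 0                                                ≡⟨ +-identityʳ _ ⟩
  count [] r                                                    ∎
count-++-beyond (p ∷ ps) {q} {r} r<q = begin
  count (p ∷ ps ++ [ q ]) r                                             ≡⟨ count-∷ p (ps ++ [ q ]) r ⟩
  sum (map (λ m → count (ps ++ [ q ]) (r ∸ m * p)) (multiplicities p r)) ≡⟨ cong sum (map-cong drop-q (multiplicities p r)) ⟩
  sum (map (λ m → count ps (r ∸ m * p)) (multiplicities p r))            ≡⟨ count-∷ p ps r ⟨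
  count (p ∷ ps) r                                                      ∎
  where
  drop-q : ∀ m → count (ps ++ [ q ]) (r ∸ m * p) ≡ count ps (r ∸ m * p)
  drop-q m = count-++-beyond ps (≤-<-trans (m∸n≤m r (m * p)) r<q)

count-double : ∀ {ps} → All NonZero ps → ∀ j → count (map (2 *_) ps) (2 * j) ≡ count ps j
count-double                []           zero    = refl
count-double                []           (suc j) = refl
count-double {ps = p ∷ ps} (p≢0 ∷ ps≢0) j       = begin
  count (2 * p ∷ map (2 *_) ps) (2 * j)
    ≡⟨ count-∷ (2 * p) (map (2 *_) ps) (2 * j) ⟩
  sum (map (λ m → count (map (2 *_) ps) (2 * j ∸ m * (2 * p))) (multiplicities (2 * p) (2 * j)))
    ≡⟨ cong sum (map-cong remainder-double (multiplicities (2 * p) (2 * j))) ⟩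
  sum (map (λ m → count ps (j ∸ m * p)) (multiplicities (2 * p) (2 * j)))
    ≡⟨ cong (sum ∘ map (λ m → count ps (j ∸ m * p))) (multiplicities-double p {{p≢0}} j) ⟩
  sum (map (λ m → count ps (j ∸ m * p)) (multiplicities p j))
    ≡⟨ count-∷ p ps j ⟨
  count (p ∷ ps) j ∎
  where
  remainder-double : ∀ m → count (map (2 *_) ps) (2 * j ∸ m * (2 * p)) ≡ count ps (j ∸ m * p)
  remainder-double m = begin
    count (map (2 *_) ps) (2 * j ∸ m * (2 * p)) ≡⟨ cong (λ k → count (map (2 *_) ps) (2 * j ∸ k)) (x∙yz≈y∙xz m 2 p) ⟩
    count (map (2 *_) ps) (2 * j ∸ 2 * (m * p)) ≡⟨ cong (count (map (2 *_) ps)) (sym (*-distribˡ-∸ 2 j (m * p))) ⟩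
    count (map (2 *_) ps) (2 * (j ∸ m * p))     ≡⟨ count-double ps≢0 (j ∸ m * p) ⟩
    count ps (j ∸ m * p)                        ∎

count-double-odd : ∀ ps j → count (map (2 *_) ps) (suc (2 * j)) ≡ 0
count-double-odd []       j = refl
count-double-odd (p ∷ ps) j = begin
  count (2 * p ∷ map (2 *_) ps) (suc (2 * j))
    ≡⟨ count-∷ (2 * p) (map (2 *_) ps) (suc (2 * j)) ⟩
  sum (map (λ m → count (map (2 *_) ps) (suc (2 * j) ∸ m * (2 * p))) (multiplicities (2 * p) (suc (2 * j))))
    ≡⟨ sum-map-const (All.map (λ {m} → remainder-odd {m}) (all-filter (λ m → m * (2 * p) ≤? suc (2 * j)) (range (suc (2 * j))))) ⟩
  0 ∎
  where
  remainder-odd : ∀ {m} → m * (2 * p) ≤ suc (2 * j) → count (map (2 *_) ps) (suc (2 * j) ∸ m * (2 * p)) ≡ 0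
  remainder-odd {m} le = begin
    count (map (2 *_) ps) (suc (2 * j) ∸ m * (2 * p))   ≡⟨ cong (λ k → count (map (2 *_) ps) (suc (2 * j) ∸ k)) (x∙yz≈y∙xz m 2 p) ⟩
    count (map (2 *_) ps) (suc (2 * j) ∸ 2 * (m * p))   ≡⟨ cong (count (map (2 *_) ps)) odd-remainder ⟩
    count (map (2 *_) ps) (suc (2 * (j ∸ m * p)))       ≡⟨ count-double-odd ps (j ∸ m * p) ⟩
    0                                                   ∎
    where
    mp≤j : m * p ≤ j
    mp≤j = m<1+n⇒m≤n (*-cancelˡ-< 2 (m * p) (suc j)
             (subst (suc (2 * (m * p)) ≤_) (sym (*-suc 2 j)) (s≤s (subst (_≤ suc (2 * j)) (x∙yz≈y∙xz m 2 p) le))))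
    odd-remainder : suc (2 * j) ∸ 2 * (m * p) ≡ suc (2 * (j ∸ m * p))
    odd-remainder = trans (+-∸-assoc 1 (*-monoʳ-≤ 2 mp≤j)) (cong suc (sym (*-distribˡ-∸ 2 j (m * p))))

evenParts : ℕ → List ℕ
evenParts L = map (2 ^_) (applyUpTo suc L)

evenB : ℕ → ℕ
evenB r = count (evenParts ⌊log₂ r ⌋) r

evenParts-∷ʳ : ∀ L → evenParts (suc L) ≡ evenParts L ++ [ 2 ^ suc L ]
evenParts-∷ʳ L = trans (cong (map (2 ^_)) (sym (applyUpTo-∷ʳ suc L))) (map-++ (2 ^_) (applyUpTo suc L) [ suc L ])

evenParts-double : ∀ L → evenParts L ≡ map (2 *_) (map (2 ^_) (upTo L))
evenParts-double L = begin
  map (2 ^_) (applyUpTo suc L)     ≡⟨ cong (map (2 ^_)) (map-upTo suc L) ⟨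
  map (2 ^_) (map suc (upTo L))    ≡⟨ map-∘ (upTo L) ⟨
  map ((2 ^_) ∘ suc) (upTo L)      ≡⟨ map-∘ (upTo L) ⟩
  map (2 *_) (map (2 ^_) (upTo L)) ∎

count-evenParts-stable : ∀ r {L L′} → L ≤′ L′ → r < 2 ^ suc L → count (evenParts L′) r ≡ count (evenParts L) r
count-evenParts-stable r ≤′-refl                r<2^[1+L] = refl
count-evenParts-stable r {L} (≤′-step {L′} L≤′L′) r<2^[1+L] = begin
  count (evenParts (suc L′)) r             ≡⟨ cong (λ ps → count ps r) (evenParts-∷ʳ L′) ⟩
  count (evenParts L′ ++ [ 2 ^ suc L′ ]) r ≡⟨ count-++-beyond (evenParts L′) r<2^[1+L′] ⟩
  count (evenParts L′) r                   ≡⟨ count-evenParts-stable r L≤′L′ r<2^[1+L] ⟩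
  count (evenParts L) r                    ∎
  where
  r<2^[1+L′] : r < 2 ^ suc L′
  r<2^[1+L′] = <-≤-trans r<2^[1+L] (^-monoʳ-≤ 2 (s≤s (≤′⇒≤ L≤′L′)))

n<2^[1+⌊log₂n⌋] : ∀ n → n < 2 ^ suc ⌊log₂ n ⌋
n<2^[1+⌊log₂n⌋] n with 2 ^ suc ⌊log₂ n ⌋ ≤? n
... | yes 2^[1+L]≤n = contradiction (subst (_≤ ⌊log₂ n ⌋) (⌊log₂[2^n]⌋≡n (suc ⌊log₂ n ⌋)) (⌊log₂⌋-mono-≤ 2^[1+L]≤n))
                                    (<⇒≱ (n<1+n _))
... | no  2^[1+L]≰n = ≰⇒> 2^[1+L]≰n

count-evenParts≡evenB : ∀ {r L} → ⌊log₂ r ⌋ ≤ L → count (evenParts L) r ≡ evenB r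
count-evenParts≡evenB {r} log≤L = count-evenParts-stable r (≤⇒≤′ log≤L) (n<2^[1+⌊log₂n⌋] r)

evenB-odd : ∀ j → evenB (suc (2 * j)) ≡ 0
evenB-odd j = trans (cong (λ ps → count ps (suc (2 * j))) (evenParts-double L)) (count-double-odd (map (2 ^_) (upTo L)) j)
  where L = ⌊log₂ suc (2 * j) ⌋

evenB-double : ∀ j → evenB (2 * j) ≡ B j
evenB-double zero        = refl
evenB-double j@(suc j-1) = begin
  count (evenParts ⌊log₂ (2 * j) ⌋) (2 * j)     ≡⟨ cong (λ L → count (evenParts L) (2 * j)) (⌊log₂[2*b]⌋≡1+⌊log₂b⌋ j) ⟩
  count (evenParts (suc ⌊log₂ j ⌋)) (2 * j)     ≡⟨ cong (λ ps → count ps (2 * j)) (evenParts-double (suc ⌊log₂ j ⌋)) ⟩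
  count (map (2 *_) (binParts j)) (2 * j)       ≡⟨ count-double (map⁺ (applyUpTo⁺₂ id (suc ⌊log₂ j ⌋) (λ i → m^n≢0 2 i))) j ⟩
  count (binParts j) j                          ∎

b₁≡∑r*evenB : ∀ n → b₁ n ≡ sum (map (λ r → r * evenB r) (range n))
b₁≡∑r*evenB zero      = refl
b₁≡∑r*evenB n@(suc _) = begin
  coeff 1 (sumP (map (hB n) (mults (1 ∷ evenParts L) n)))
    ≡⟨ coeff₁-sumP (map (hB n) (mults (1 ∷ evenParts L) n)) ⟩
  sum (map (coeff 1) (map (hB n) (mults (1 ∷ evenParts L) n)))
    ≡⟨ cong sum (map-∘ (mults (1 ∷ evenParts L) n)) ⟨
  sum (map (coeff 1 ∘ hB n) (concatMap (λ m → map (m ∷_) (rest m)) (multiplicities 1 n)))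
    ≡⟨ sum-concatMap (coeff 1 ∘ hB n) (λ m → map (m ∷_) (rest m)) (multiplicities 1 n) ⟩
  sum (map (λ m → sum (map (coeff 1 ∘ hB n) (map (m ∷_) (rest m)))) (multiplicities 1 n))
    ≡⟨ cong sum (map-cong weight (multiplicities 1 n)) ⟩
  sum (map (λ m → (n ∸ m) * evenB (n ∸ m)) (multiplicities 1 n))
    ≡⟨ cong (sum ∘ map (λ m → (n ∸ m) * evenB (n ∸ m))) (multiplicities-one n) ⟩
  sum (map (λ m → (n ∸ m) * evenB (n ∸ m)) (range n))
    ≡⟨ sum-range-reflect (λ r → r * evenB r) n ⟩
  sum (map (λ r → r * evenB r) (range n)) ∎
  where
  L : ℕ
  L = ⌊log₂ n ⌋
  rest : ℕ → List (List ℕ)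
  rest m = mults (evenParts L) (n ∸ m * 1)
  weight : ∀ m → sum (map (coeff 1 ∘ hB n) (map (m ∷_) (rest m))) ≡ (n ∸ m) * evenB (n ∸ m)
  weight m = begin
    sum (map (coeff 1 ∘ hB n) (map (m ∷_) (rest m)))
      ≡⟨ cong sum (map-∘ (rest m)) ⟨
    sum (map (coeff 1 ∘ hB n ∘ (m ∷_)) (rest m))
      ≡⟨ sum-map-const (All.universal (hB-coeff₁ n m) (rest m)) ⟩
    (n ∸ m) * count (evenParts L) (n ∸ m * 1)
      ≡⟨ cong (λ k → (n ∸ m) * count (evenParts L) (n ∸ k)) (*-identityʳ m) ⟩
    (n ∸ m) * count (evenParts L) (n ∸ m)
      ≡⟨ cong ((n ∸ m) *_) (count-evenParts≡evenB (⌊log₂⌋-mono-≤ (m∸n≤m n m))) ⟩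
    (n ∸ m) * evenB (n ∸ m) ∎

b₁-suc : ∀ n → b₁ (suc n) ≡ b₁ n + suc n * evenB (suc n)
b₁-suc n = begin
  b₁ (suc n)                                                    ≡⟨ b₁≡∑r*evenB (suc n) ⟩
  sum (map (λ r → r * evenB r) (range (suc n)))                 ≡⟨ sum-range-∷ʳ (λ r → r * evenB r) n ⟩
  sum (map (λ r → r * evenB r) (range n)) + suc n * evenB (suc n) ≡⟨ cong (_+ suc n * evenB (suc n)) (b₁≡∑r*evenB n) ⟨
  b₁ n + suc n * evenB (suc n)                                  ∎

+[m+n]-[+m]≡+n : ∀ m n → + (m + n) - + m ≡ + n
+[m+n]-[+m]≡+n m n = trans ([+m]-[+n]≡m⊖n (m + n) m) (trans (⊖-≥ (m≤m+n m n)) (cong +_ (m+n∸m≡n m n)))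

proposition4p7 : (n : ℕ) →
    (n % 2 ≡ 0 → + b₁ (suc n) - + b₁ n ≡ + 0) ×
    (n % 2 ≡ 1 → + b₁ (suc n) - + b₁ n ≡ + (suc n * B (suc n / 2)))
proposition4p7 n = n-even , n-odd
  where
  increment : + b₁ (suc n) - + b₁ n ≡ + (suc n * evenB (suc n))
  increment = trans (cong (λ k → + k - + b₁ n) (b₁-suc n)) (+[m+n]-[+m]≡+n (b₁ n) _)
  n-even : n % 2 ≡ 0 → + b₁ (suc n) - + b₁ n ≡ + 0
  n-even n%2≡0 = begin
    + b₁ (suc n) - + b₁ n                  ≡⟨ increment ⟩
    + (suc n * evenB (suc n))              ≡⟨ cong (λ k → + (suc n * evenB (suc k))) (m*[n/m]≡n (m%n≡0⇒n∣m n 2 n%2≡0)) ⟨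
    + (suc n * evenB (suc (2 * (n / 2)))) ≡⟨ cong (λ k → + (suc n * k)) (evenB-odd (n / 2)) ⟩
    + (suc n * 0)                          ≡⟨ cong +_ (*-zeroʳ (suc n)) ⟩
    + 0                                    ∎
  n-odd : n % 2 ≡ 1 → + b₁ (suc n) - + b₁ n ≡ + (suc n * B (suc n / 2))
  n-odd n%2≡1 = begin
    + b₁ (suc n) - + b₁ n                  ≡⟨ increment ⟩
    + (suc n * evenB (suc n))              ≡⟨ cong (λ k → + (suc n * evenB k)) (m*[n/m]≡n (m%n≡0⇒n∣m (suc n) 2 [1+n]%2≡0)) ⟨
    + (suc n * evenB (2 * (suc n / 2)))   ≡⟨ cong (λ k → + (suc n * k)) (evenB-double (suc n / 2)) ⟩
    + (suc n * B (suc n / 2))              ∎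
    where
    [1+n]%2≡0 : suc n % 2 ≡ 0
    [1+n]%2≡0 = trans (%-distribˡ-+ 1 n 2) (cong (λ k → (1 % 2 + k) % 2) n%2≡1)
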